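{- Let $\widehat{X}$ be a sandpile graph that is undirected and such that $X$ (the graph obtained by deleting the sink) is connected. If $X$ consists of a single loopless vertex, then $\mathcal{M}(\widehat{X})$ has exactly one idempotent (namely $0$). Otherwise, $\mathcal{M}(\widehat{X})$ has exactly two idempotents ($0$ and the identity of the sandpile group $\mathcal{G}(\widehat{X})$).
   Context: A sandpile graph $\widehat{X}$ is a finite weakly connected directed multigraph (loops and multiple edges allowed) with a distinguished vertex, the sink, reachable by a directed path from every vertex; the set of non-sink vertices is nonempty. An undirected graph is regarded as a directed one by replacing each edge with a pair of opposite directed edges. A configuration assigns a nonnegative integer number of grains to each non-sink vertex; it is stable if every $v$ holds fewer than $\deg^{+}(v)$ (out-degree) grains. Toppling an unstable vertex sends one grain along each of its out-edges (grains at the sink vanish; the sink never topples); every configuration has a unique stabilization. $\mathcal{M}(\widehat X)$ is the set of stable configurations with $a\oplus b$ = stabilization of $a+b$ (commutative monoid with identity the empty configuration $0$). $\mathcal G(\widehat X)$ is the minimal ideal of $\mathcal M(\widehat X)$, which is a group. -}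

module Defs where

open import Data.Nat using (ℕ; zero; suc; _+_; _*_; _∸_; _≤_; _<_)
open import Data.Fin using (Fin)
open import Data.Fin.Properties using (_≟_)
open import Data.Vec using (Vec; lookup; tabulate; zipWith; replicate; sum)
open import Data.Product using (Σ; _×_; ∃)
open import Relation.Nullary using (yes; no; ¬_)
open import Relation.Binary.PropositionalEquality using (_≡_)
open import Relation.Binary.Construct.Closure.ReflexiveTransitive using (Star)

-- An undirected sandpile graph with non-sink vertices Fin n and one extra
-- vertex, the sink, is given by
--   E v w : number of undirected edges between non-sink vertices v and w
--           (E v v = number of loops at v); E must be symmetric,
--   S v   : number of undirected edges between v and the sink.
-- (Loops at the sink never influence the dynamics and are omitted.)

Symmetric : ∀ {n} → (Fin n → Fin n → ℕ) → Set
Symmetric E = ∀ v w → E v w ≡ E w v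

module Sandpile {n : ℕ} (E : Fin n → Fin n → ℕ) (S : Fin n → ℕ) where

  -- directed multiplicity of edges v → w between non-sink vertices,
  -- each undirected edge becoming a pair of opposite directed edges
  -- (so a loop gives two directed loops)
  D : Fin n → Fin n → ℕ
  D v w with v ≟ w
  ... | yes _ = 2 * E v v
  ... | no  _ = E v w

  deg : Fin n → ℕ
  deg v = sum (tabulate (D v)) + S v

  data SinkReachable : Fin n → Set where
    direct : ∀ {v} → 0 < S v → SinkReachable v
    via    : ∀ {v w} → 0 < E v w → SinkReachable w → SinkReachable v

  -- sandpile-graph conditions: non-sink vertex set nonempty, sink reachable
  -- from every vertex (this also gives weak connectivity)
  IsSandpileGraph : Set
  IsSandpileGraph = (0 < n) × (∀ v → SinkReachable v)

  data PathX : Fin n → Fin n → Set where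
    here : ∀ {v} → PathX v v
    step : ∀ {u v w} → 0 < E u v → PathX v w → PathX u w

  ConnectedX : Set
  ConnectedX = ∀ v w → PathX v w

  SingleLooplessVertex : Set
  SingleLooplessVertex = (n ≡ 1) × (∀ v → E v v ≡ 0)

  Config : Set
  Config = Vec ℕ n

  Stable : Config → Set
  Stable c = ∀ v → lookup c v < deg v

  _⊞_ : Config → Config → Config
  a ⊞ b = zipWith _+_ a b

  zeroC : Config
  zeroC = replicate n 0

  toppleAt : Fin n → Config → Config
  toppleAt v c = tabulate λ w → (lookup c w ∸ loss w) + D v w
    where
    loss : Fin n → ℕ
    loss w with w ≟ v
    ... | yes _ = deg v
    ... | no  _ = 0

  data _⟶_ : Config → Config → Set where
    topple : ∀ {c} v → deg v ≤ lookup c v → c ⟶ toppleAt v c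

  -- c stabilizes to d (stabilizations are unique, so this is d = stab c)
  StabilizesTo : Config → Config → Set
  StabilizesTo c d = Star _⟶_ c d × Stable d

  -- elements of the sandpile monoid M are stable configurations;
  -- e is an idempotent of M: e ⊕ e = e
  Idempotent : Config → Set
  Idempotent e = Stable e × StabilizesTo (e ⊞ e) e

  -- membership in the minimal ideal G of M.  For a finite commutative monoid,
  -- the minimal ideal is the intersection of all principal ideals y ⊕ M.
  InMinimalIdeal : Config → Set
  InMinimalIdeal x = Stable x ×
    (∀ y → Stable y → ∃ λ z → Stable z × StabilizesTo (y ⊞ z) x)

{-# OPTIONS --safe #-}
-- If s counts the topplings in a run e ⊞ e ⟶* e, then e = Δ s for the reduced Laplacian Δ.
-- When s vanishes somewhere it vanishes everywhere, since (Δ s) v ≥ 0 forces s to vanish at the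
-- neighbours of a vertex where it vanishes and X is connected; then e = 0. Otherwise every vertex
-- toppled, and Dhar's burning argument shows that e has no forbidden subconfiguration. A discrete
-- maximum principle shows that two stable configurations without forbidden subconfigurations whose
-- difference lies in the image of Δ are equal; hence e = g, the stabilization of 2 cmax − (2 cmax)°.
-- The same uniqueness gives g ⊕ g = g and g ∈ y ⊕ M for every stable y, and g ≠ 0 because every
-- vertex has a neighbour in X unless X is a single loopless vertex. If X has no edges at all,
-- e v = deg v * s v < deg v forces e = 0.
module Submission where

open import Defs
open import Data.Nat as ℕ using (ℕ; zero; suc; _+_; _*_; _∸_; _≤_; _<_; z≤n; _≤?_; _<?_; >-nonZero)
open import Data.Nat.Properties hiding (_≟_)
open import Data.Nat.Tactic.RingSolver using (solve-∀)
open import Data.Fin using (Fin; zero; suc; fromℕ<)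
open import Data.Fin.Properties using (_≟_; all?; any?; ¬∀⟶∃¬)
open import Data.Bool using (Bool; true; false; if_then_else_; T)
import Data.Bool.Properties as Bool
open import Data.Vec as Vec using (lookup; tabulate)
open import Data.Vec.Properties using (lookup∘tabulate; tabulate∘lookup; tabulate-cong; lookup-zipWith; lookup-replicate)
open import Data.Product using (Σ; _×_; _,_; ∃; proj₁; proj₂)
open import Data.Sum using (_⊎_; inj₁; inj₂)
open import Data.Unit using (⊤; tt)
open import Data.Empty using (⊥)
open import Function using (_∘_; _∋_; Equivalence)
open import Relation.Nullary using (yes; no; ¬_; ¬?; contradiction)
open import Relation.Binary.PropositionalEquality
open import Relation.Binary.Construct.Closure.ReflexiveTransitive using (Star; ε; _◅_; _◅◅_)
open import Algebra.Properties.Semiring.Sum +-*-semiring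
  using (sum; sum-cong-≗; ∑-distrib-+; *-distribʳ-sum; sum-replicate-zero)
open import Algebra.Properties.CommutativeSemigroup +-commutativeSemigroup
  using (x∙yz≈xz∙y; xy∙z≈xz∙y; x∙yz≈yx∙z; interchange)

sum-tabulate : ∀ {m} (f : Fin m → ℕ) → Vec.sum (tabulate f) ≡ sum f
sum-tabulate {zero}  f = refl
sum-tabulate {suc m} f = cong (f zero +_) (sum-tabulate (f ∘ suc))

sum-zero : ∀ {m} {f : Fin m → ℕ} → (∀ i → f i ≡ 0) → sum f ≡ 0
sum-zero {m} f≡0 = trans (sum-cong-≗ f≡0) (sum-replicate-zero m)

sum-mono-≤ : ∀ {m} {f g : Fin m → ℕ} → (∀ i → f i ≤ g i) → sum f ≤ sum g
sum-mono-≤ {zero}  f≤g = z≤n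
sum-mono-≤ {suc m} f≤g = +-mono-≤ (f≤g zero) (sum-mono-≤ (f≤g ∘ suc))

≤-sum : ∀ {m} (f : Fin m → ℕ) i → f i ≤ sum f
≤-sum f zero    = m≤m+n _ _
≤-sum f (suc i) = ≤-trans (≤-sum (f ∘ suc) i) (m≤n+m _ _)

δ : ∀ {m} → Fin m → Fin m → ℕ
δ zero    zero    = 1
δ zero    (suc _) = 0
δ (suc _) zero    = 0
δ (suc x) (suc u) = δ x u

δ-refl : ∀ {m} (x : Fin m) → δ x x ≡ 1
δ-refl zero    = refl
δ-refl (suc x) = δ-refl x

δ-≢ : ∀ {m} {x u : Fin m} → u ≢ x → δ x u ≡ 0
δ-≢ {x = zero}  {zero}  u≢x = contradiction refl u≢x
δ-≢ {x = zero}  {suc u} _   = refl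
δ-≢ {x = suc x} {zero}  _   = refl
δ-≢ {x = suc x} {suc u} u≢x = δ-≢ (u≢x ∘ cong suc)

*-δ : ∀ {m} (f : Fin m → ℕ) x u → f u * δ x u ≡ f x * δ x u
*-δ f x u with u ≟ x
... | yes refl = refl
... | no  u≢x rewrite δ-≢ u≢x = trans (*-zeroʳ (f u)) (sym (*-zeroʳ (f x)))

sum-*δ : ∀ {m} (f : Fin m → ℕ) x → sum (λ u → f u * δ x u) ≡ f x
sum-*δ f zero    = trans (cong₂ _+_ (*-identityʳ (f zero)) (sum-zero λ u → *-zeroʳ (f (suc u))))
                         (+-identityʳ (f zero))
sum-*δ f (suc x) = trans (cong (_+ sum (λ u → f (suc u) * δ x u)) (*-zeroʳ (f zero))) (sum-*δ (f ∘ suc) x)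

argmax : ∀ {m} (f : Fin m → ℕ) → Fin m → ∃ λ i → ∀ j → f j ≤ f i
argmax {suc zero}    f _ = zero , λ { zero → ≤-refl }
argmax {suc (suc m)} f _ with argmax (f ∘ suc) zero
... | i , fj≤fi with f zero ≤? f (suc i)
...   | yes f0≤fi = suc i , λ { zero → f0≤fi ; (suc j) → fj≤fi j }
...   | no  f0≰fi = zero , λ { zero → ≤-refl ; (suc j) → ≤-trans (fj≤fi j) (<⇒≤ (≰⇒> f0≰fi)) }

<-multiple⇒≡0 : ∀ {a d} t → a < d → a ≡ d * t → a ≡ 0
<-multiple⇒≡0 {d = d} zero _ a≡dt = trans a≡dt (*-zeroʳ d)
<-multiple⇒≡0 {d = d} (suc t) a<d a≡dt =
  contradiction (subst (d ≤_) (sym a≡dt) (m≤m*n d (suc t))) (<⇒≱ a<d)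

Fin-unique : ∀ {m} → m ≡ 1 → (u v : Fin m) → u ≡ v
Fin-unique refl zero zero = refl

unique⇒≡1 : ∀ {m} (v : Fin m) → (∀ u → u ≡ v) → m ≡ 1
unique⇒≡1 {suc zero}    v u≡v = refl
unique⇒≡1 {suc (suc m)} v u≡v with trans (u≡v zero) (sym (u≡v (suc zero)))
... | ()

module UndirectedSandpile {n : ℕ} (E : Fin n → Fin n → ℕ) (S : Fin n → ℕ) (symE : Symmetric E) where
  open Sandpile E S

  lookup-extensionality : ∀ {a b : Config} → (∀ v → lookup a v ≡ lookup b v) → a ≡ b
  lookup-extensionality {a} {b} a≗b =
    trans (sym (tabulate∘lookup a)) (trans (tabulate-cong a≗b) (tabulate∘lookup b))

  lookup-⊞ : ∀ a b v → lookup (a ⊞ b) v ≡ lookup a v + lookup b v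
  lookup-⊞ a b v = lookup-zipWith _+_ v a b

  ⊞-comm : ∀ a b → a ⊞ b ≡ b ⊞ a
  ⊞-comm a b = lookup-extensionality λ v →
    trans (lookup-⊞ a b v) (trans (+-comm (lookup a v) (lookup b v)) (sym (lookup-⊞ b a v)))

  lookup-zeroC : ∀ v → lookup zeroC v ≡ 0
  lookup-zeroC v = lookup-replicate v 0

  ≡zeroC : ∀ {c} → (∀ v → lookup c v ≡ 0) → c ≡ zeroC
  ≡zeroC c≡0 = lookup-extensionality λ v → trans (c≡0 v) (sym (lookup-zeroC v))

  D-sym : ∀ u v → D u v ≡ D v u
  D-sym u v with u ≟ v | v ≟ u
  ... | yes refl | yes _   = refl
  ... | yes refl | no  v≢u = contradiction refl v≢u
  ... | no  u≢v  | yes v≡u = contradiction (sym v≡u) u≢v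
  ... | no  _    | no  _   = symE u v

  D-pos : ∀ {u v} → 0 < E u v → 0 < D u v
  D-pos {u} {v} 0<E with u ≟ v
  ... | yes refl = ≤-trans 0<E (m≤m+n (E u u) _)
  ... | no  _    = 0<E

  D-zero : (∀ u v → E u v ≡ 0) → ∀ u v → D u v ≡ 0
  D-zero E≡0 u v with u ≟ v
  ... | yes refl = cong (2 *_) (E≡0 u u)
  ... | no  _    = E≡0 u v

  degX : Fin n → ℕ
  degX v = sum (D v)

  deg≡degX+S : ∀ v → deg v ≡ degX v + S v
  deg≡degX+S v = cong (_+ S v) (sum-tabulate (D v))

  deg-positive : ∀ {v} → SinkReachable v → 0 < deg v
  deg-positive {v} (direct 0<S) = subst (0 <_) (sym (deg≡degX+S v)) (≤-trans 0<S (m≤n+m _ _))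
  deg-positive {v} (via {w = w} 0<E _) = subst (0 <_) (sym (deg≡degX+S v))
    (≤-trans (D-pos 0<E) (≤-trans (≤-sum (D v) w) (m≤m+n _ _)))

  -- a copy of the local function loss in the definition of toppleAt, which is out of scope here
  lost : Fin n → Fin n → ℕ
  lost x v with v ≟ x
  ... | yes _ = deg x
  ... | no  _ = 0

  lookup-toppleAt : ∀ x c v → lookup (toppleAt x c) v ≡ (lookup c v ∸ lost x v) + D x v
  -- matching on v ≟ x reduces loss and lost alike
  lookup-toppleAt x c v with (lookup (toppleAt x c) v ≡ _ ∋ lookup∘tabulate _ v)
  ... | eq with v ≟ x
  ...   | yes _ = eq
  ...   | no  _ = eq

  lost≤ : ∀ {x c} → deg x ≤ lookup c x → ∀ v → lost x v ≤ lookup c v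
  lost≤ {x} x-unstable v with v ≟ x
  ... | yes refl = x-unstable
  ... | no  _    = z≤n

  toppleAt-balance : ∀ x c → deg x ≤ lookup c x →
    ∀ v → lookup (toppleAt x c) v + deg x * δ x v ≡ lookup c v + D x v
  toppleAt-balance x c x-unstable v rewrite lookup-toppleAt x c v with v ≟ x
  ... | yes refl rewrite δ-refl v | *-identityʳ (deg v) = begin
      lookup c v ∸ deg v + D v v + deg v  ≡⟨ xy∙z≈xz∙y (lookup c v ∸ deg v) (D v v) (deg v) ⟩
      lookup c v ∸ deg v + deg v + D v v  ≡⟨ cong (_+ D v v) (m∸n+n≡m x-unstable) ⟩
      lookup c v + D v v                  ∎
    where open ≡-Reasoning
  ... | no  v≢x rewrite δ-≢ v≢x | *-zeroʳ (deg x) = +-identityʳ _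

  toppleAt-self : ∀ x c → deg x ≤ lookup c x → lookup (toppleAt x c) x + deg x ≡ lookup c x + D x x
  toppleAt-self x c x-unstable =
    trans (cong (λ k → lookup (toppleAt x c) x + k) (sym (trans (cong (deg x *_) (δ-refl x)) (*-identityʳ (deg x)))))
          (toppleAt-balance x c x-unstable x)

  toppleAt-≢ : ∀ x c → deg x ≤ lookup c x → ∀ {v} → v ≢ x → lookup (toppleAt x c) v ≡ lookup c v + D x v
  toppleAt-≢ x c x-unstable {v} v≢x =
    trans (sym (trans (cong (λ k → lookup (toppleAt x c) v + deg x * k) (δ-≢ v≢x))
                      (trans (cong (lookup (toppleAt x c) v +_) (*-zeroʳ (deg x))) (+-identityʳ _))))
          (toppleAt-balance x c x-unstable v)

  toppleAt-⊞ : ∀ {x c} a → deg x ≤ lookup c x → toppleAt x (c ⊞ a) ≡ toppleAt x c ⊞ a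
  toppleAt-⊞ {x} {c} a x-unstable = lookup-extensionality λ v → begin
      lookup (toppleAt x (c ⊞ a)) v                 ≡⟨ lookup-toppleAt x (c ⊞ a) v ⟩
      (lookup (c ⊞ a) v ∸ lost x v) + D x v          ≡⟨ cong (λ k → (k ∸ lost x v) + D x v) (lookup-⊞ c a v) ⟩
      (lookup c v + lookup a v ∸ lost x v) + D x v   ≡⟨ cong (_+ D x v) (+-∸-comm (lookup a v) (lost≤ {x} {c} x-unstable v)) ⟩
      (lookup c v ∸ lost x v) + lookup a v + D x v   ≡⟨ xy∙z≈xz∙y _ (lookup a v) (D x v) ⟩
      (lookup c v ∸ lost x v) + D x v + lookup a v   ≡⟨ cong (_+ lookup a v) (sym (lookup-toppleAt x c v)) ⟩
      lookup (toppleAt x c) v + lookup a v           ≡⟨ sym (lookup-⊞ (toppleAt x c) a v) ⟩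
      lookup (toppleAt x c ⊞ a) v                   ∎
    where open ≡-Reasoning

  run-⊞ : ∀ {c d} a → Star _⟶_ c d → Star _⟶_ (c ⊞ a) (d ⊞ a)
  run-⊞ a ε = ε
  run-⊞ {c} a (topple x x-unstable ◅ st) =
    subst ((c ⊞ a) ⟶_) (toppleAt-⊞ {x} {c} a x-unstable) (topple x still-unstable) ◅ run-⊞ a st
    where
    still-unstable : deg x ≤ lookup (c ⊞ a) x
    still-unstable = ≤-trans x-unstable (≤-trans (m≤m+n _ _) (≤-reflexive (sym (lookup-⊞ c a x))))

  topplings : ∀ {c d} → Star _⟶_ c d → Fin n → ℕ
  topplings ε                 v = 0
  topplings (topple x _ ◅ st) v = δ x v + topplings st v

  received : (Fin n → ℕ) → Fin n → ℕ
  received t v = sum (λ u → D u v * t u)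

  received-+ : ∀ f g v → received (λ u → f u + g u) v ≡ received f v + received g v
  received-+ f g v = trans (sum-cong-≗ λ u → *-distribˡ-+ (D u v) (f u) (g u))
                           (∑-distrib-+ (λ u → D u v * f u) (λ u → D u v * g u))

  received-δ : ∀ x v → received (δ x) v ≡ D x v
  received-δ x v = sum-*δ (λ u → D u v) x

  received-zero : ∀ v → received (λ _ → 0) v ≡ 0
  received-zero v = sum-zero λ u → *-zeroʳ (D u v)

  received-const : ∀ k v → received (λ _ → k) v ≡ degX v * k
  received-const k v = trans (sum-cong-≗ λ u → cong (_* k) (D-sym u v)) (sym (*-distribʳ-sum k (D v)))

  run-balance : ∀ {c d} (st : Star _⟶_ c d) v →
    lookup d v + deg v * topplings st v ≡ lookup c v + received (topplings st) v
  run-balance {c} ε v = trans (cong (lookup c v +_) (*-zeroʳ (deg v)))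
                              (sym (cong (lookup c v +_) (received-zero v)))
  run-balance {c} {d} (topple x x-unstable ◅ st) v = begin
      lookup d v + deg v * (δ x v + t v)                  ≡⟨ cong (lookup d v +_) (*-distribˡ-+ (deg v) (δ x v) (t v)) ⟩
      lookup d v + (deg v * δ x v + deg v * t v)          ≡⟨ x∙yz≈xz∙y (lookup d v) _ _ ⟩
      (lookup d v + deg v * t v) + deg v * δ x v          ≡⟨ cong₂ _+_ (run-balance st v) (*-δ deg x v) ⟩
      (lookup (toppleAt x c) v + received t v) + deg x * δ x v  ≡⟨ xy∙z≈xz∙y (lookup (toppleAt x c) v) (received t v) (deg x * δ x v) ⟩
      (lookup (toppleAt x c) v + deg x * δ x v) + received t v  ≡⟨ cong (_+ received t v) (toppleAt-balance x c x-unstable v) ⟩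
      (lookup c v + D x v) + received t v                 ≡⟨ +-assoc (lookup c v) _ _ ⟩
      lookup c v + (D x v + received t v)                 ≡⟨ cong (λ k → lookup c v + (k + received t v)) (sym (received-δ x v)) ⟩
      lookup c v + (received (δ x) v + received t v)      ≡⟨ cong (lookup c v +_) (sym (received-+ (δ x) t v)) ⟩
      lookup c v + received (λ u → δ x u + t u) v         ∎
    where
    open ≡-Reasoning
    t = topplings st

  toppleAt-grains : ∀ x c → deg x ≤ lookup c x → sum (lookup (toppleAt x c)) + S x ≡ sum (lookup c)
  toppleAt-grains x c x-unstable = +-cancelʳ-≡ (degX x) _ _ (begin
      sum (lookup c′) + S x + degX x                       ≡⟨ x∙yz≈xz∙y (sum (lookup c′)) _ _ ⟨
      sum (lookup c′) + (degX x + S x)                     ≡⟨ cong (sum (lookup c′) +_) (sym (deg≡degX+S x)) ⟩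
      sum (lookup c′) + deg x                              ≡⟨ cong (sum (lookup c′) +_) (sum-*δ (λ _ → deg x) x) ⟨
      sum (lookup c′) + sum (λ v → deg x * δ x v)          ≡⟨ ∑-distrib-+ (lookup c′) (λ v → deg x * δ x v) ⟨
      sum (λ v → lookup c′ v + deg x * δ x v)              ≡⟨ sum-cong-≗ (toppleAt-balance x c x-unstable) ⟩
      sum (λ v → lookup c v + D x v)                       ≡⟨ ∑-distrib-+ (lookup c) (D x) ⟩
      sum (lookup c) + degX x                              ∎)
    where
    open ≡-Reasoning
    c′ = toppleAt x c

  run-grains : ∀ {c d} (st : Star _⟶_ c d) → sum (lookup d) + sum (λ u → S u * topplings st u) ≡ sum (lookup c)
  run-grains {c} ε = trans (cong (sum (lookup c) +_) (sum-zero λ u → *-zeroʳ (S u))) (+-identityʳ _)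
  run-grains {c} {d} (topple x x-unstable ◅ st) = begin
      sum (lookup d) + sum (λ u → S u * (δ x u + t u))
        ≡⟨ cong (sum (lookup d) +_) (trans (sum-cong-≗ λ u → *-distribˡ-+ (S u) (δ x u) (t u))
                                                     (∑-distrib-+ (λ u → S u * δ x u) (λ u → S u * t u))) ⟩
      sum (lookup d) + (sum (λ u → S u * δ x u) + sum (λ u → S u * t u))
        ≡⟨ cong (λ k → sum (lookup d) + (k + sum (λ u → S u * t u))) (sum-*δ S x) ⟩
      sum (lookup d) + (S x + sum (λ u → S u * t u))
        ≡⟨ x∙yz≈xz∙y (sum (lookup d)) (S x) _ ⟩
      sum (lookup d) + sum (λ u → S u * t u) + S x
        ≡⟨ cong (_+ S x) (run-grains st) ⟩
      sum (lookup (toppleAt x c)) + S x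
        ≡⟨ toppleAt-grains x c x-unstable ⟩
      sum (lookup c)
        ∎
    where
    open ≡-Reasoning
    t = topplings st

  -- Every toppling of v sends a grain to the sink or to the next vertex w on a path to it,
  -- and w cannot absorb more than the initial grains plus deg w per toppling of its own.
  topplingBound : ℕ → ∀ {v} → SinkReachable v → ℕ
  topplingBound N (direct _)          = N
  topplingBound N (via {w = w} _ p) = N + deg w * topplingBound N p

  topplings-≤ : ∀ {c d} (st : Star _⟶_ c d) {v} (p : SinkReachable v) →
    topplings st v ≤ topplingBound (sum (lookup c)) p
  topplings-≤ {c} {d} st {v} (direct 0<S) = begin
      t v                                   ≤⟨ m≤n*m (t v) (S v) {{>-nonZero 0<S}} ⟩
      S v * t v                             ≤⟨ ≤-sum (λ u → S u * t u) v ⟩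
      sum (λ u → S u * t u)                 ≤⟨ m≤n+m _ (sum (lookup d)) ⟩
      sum (lookup d) + sum (λ u → S u * t u) ≡⟨ run-grains st ⟩
      sum (lookup c)                        ∎
    where
    open ≤-Reasoning
    t = topplings st
  topplings-≤ {c} {d} st {v} (via {w = w} 0<E p) = begin
      t v                                ≤⟨ m≤n*m (t v) (D v w) {{>-nonZero (D-pos 0<E)}} ⟩
      D v w * t v                        ≤⟨ ≤-sum (λ u → D u w * t u) v ⟩
      received t w                       ≤⟨ m≤n+m _ (lookup c w) ⟩
      lookup c w + received t w          ≡⟨ run-balance st w ⟨
      lookup d w + deg w * t w           ≤⟨ +-mono-≤ d-w≤grains (*-monoʳ-≤ (deg w) (topplings-≤ st p)) ⟩
      sum (lookup c) + deg w * topplingBound (sum (lookup c)) p ∎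
    where
    open ≤-Reasoning
    t = topplings st
    d-w≤grains : lookup d w ≤ sum (lookup c)
    d-w≤grains = ≤-trans (≤-sum (lookup d) w) (≤-trans (m≤m+n _ _) (≤-reflexive (run-grains st)))

  topplings-◅◅ : ∀ {c d e} (st : Star _⟶_ c d) (st′ : Star _⟶_ d e) v →
    topplings (st ◅◅ st′) v ≡ topplings st v + topplings st′ v
  topplings-◅◅ ε                 st′ v = refl
  topplings-◅◅ (topple x _ ◅ st) st′ v =
    trans (cong (δ x v +_) (topplings-◅◅ st st′ v)) (sym (+-assoc (δ x v) _ _))

  module Stabilization (sinkReachable : ∀ v → SinkReachable v) where

    -- opaque, so that type checking never unfolds the search for a stable configuration
    opaque
      stabilize : (c : Config) → ∃ λ d → Star _⟶_ c d × Stable d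
      stabilize c = go (suc bound) c ε nothing-toppled
        where
        bound : ℕ
        bound = sum (λ v → topplingBound (sum (lookup c)) (sinkReachable v))

        nothing-toppled : bound < sum (topplings {c} ε) + suc bound
        nothing-toppled = subst (λ k → bound < k + suc bound) (sym (sum-zero {f = topplings {c} ε} λ _ → refl)) (n<1+n bound)

        go : ∀ fuel d (st : Star _⟶_ c d) → bound < sum (topplings st) + fuel →
             ∃ λ d′ → Star _⟶_ c d′ × Stable d′
        go fuel d st bound<total with all? (λ v → lookup d v <? deg v)
        ... | yes d-stable = d , st , d-stable
        ... | no  d-unstable with ¬∀⟶∃¬ n _ (λ v → lookup d v <? deg v) d-unstable
        ...   | x , x-unstable with fuel
        ...     | zero = contradiction (sum-mono-≤ λ v → topplings-≤ st (sinkReachable v))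
                                       (<⇒≱ (subst (bound <_) (+-identityʳ _) bound<total))
        ...     | suc fuel′ = go fuel′ _ st′ (subst (bound <_) total≡ bound<total)
          where
          st′ : Star _⟶_ c (toppleAt x d)
          st′ = st ◅◅ (topple x (≮⇒≥ x-unstable) ◅ ε)
          total≡ : sum (topplings st) + suc fuel′ ≡ sum (topplings st′) + fuel′
          total≡ = begin
              sum (topplings st) + suc fuel′                    ≡⟨ +-suc _ fuel′ ⟩
              suc (sum (topplings st)) + fuel′                  ≡⟨ cong (λ k → k + fuel′) (+-comm 1 _) ⟩
              sum (topplings st) + 1 + fuel′                    ≡⟨ cong (λ k → sum (topplings st) + k + fuel′) (sum-*δ (λ _ → 1) x) ⟨
              sum (topplings st) + sum (λ v → 1 * δ x v) + fuel′  ≡⟨ cong (_+ fuel′) (∑-distrib-+ (topplings st) (λ v → 1 * δ x v)) ⟨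
              sum (λ v → topplings st v + 1 * δ x v) + fuel′    ≡⟨ cong (_+ fuel′) (sum-cong-≗ λ v → sym (topplings-◅◅ st _ v)) ⟩
              sum (topplings st′) + fuel′                       ∎
            where open ≡-Reasoning

  if-≤ : ∀ b m → (if b then m else 0) ≤ m
  if-≤ true  m = ≤-refl
  if-≤ false m = z≤n

  degIn : (Fin n → Bool) → Fin n → ℕ
  degIn F v = sum (λ u → if F u then D v u else 0)

  -- A forbidden subconfiguration of c is a nonempty F with lookup c v < degIn F v for all v in F;
  -- the stable configurations without one are the recurrent ones (Dhar's burning criterion).
  record NoForbiddenIn (P : Fin n → Set) (c : Config) : Set where
    field
      allowedVertex : ∀ F → (∀ u → F u ≡ true → P u) → (∃ λ u → F u ≡ true) →
                      ∃ λ v → F v ≡ true × degIn F v ≤ lookup c v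
  open NoForbiddenIn

  NoForbidden : Config → Set
  NoForbidden = NoForbiddenIn (λ _ → ⊤)

  _∖_ : (Fin n → Bool) → Fin n → Fin n → Bool
  (F ∖ x) u with u ≟ x
  ... | yes _ = false
  ... | no  _ = F u

  ∖-true : ∀ F x {u} → (F ∖ x) u ≡ true → F u ≡ true × u ≢ x
  ∖-true F x {u} F∖x-u with u ≟ x
  ... | yes _   = contradiction F∖x-u λ ()
  ... | no  u≢x = F∖x-u , u≢x

  degIn-∖ : ∀ F x → F x ≡ true → ∀ v → degIn F v ≡ degIn (F ∖ x) v + D v x
  degIn-∖ F x Fx v = begin
      degIn F v                                               ≡⟨ sum-cong-≗ split ⟩
      sum (λ u → (if (F ∖ x) u then D v u else 0) + D v u * δ x u)
        ≡⟨ ∑-distrib-+ (λ u → if (F ∖ x) u then D v u else 0) (λ u → D v u * δ x u) ⟩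
      degIn (F ∖ x) v + sum (λ u → D v u * δ x u)             ≡⟨ cong (degIn (F ∖ x) v +_) (sum-*δ (D v) x) ⟩
      degIn (F ∖ x) v + D v x                                 ∎
    where
    open ≡-Reasoning
    split : ∀ u → (if F u then D v u else 0) ≡ (if (F ∖ x) u then D v u else 0) + D v u * δ x u
    split u with u ≟ x
    ... | yes refl rewrite Fx | δ-refl u = sym (*-identityʳ (D v u))
    ... | no  u≢x  rewrite δ-≢ u≢x | *-zeroʳ (D v u) = sym (+-identityʳ _)

  degIn-empty : ∀ {G} → (∀ u → G u ≢ true) → ∀ v → degIn G v ≡ 0
  degIn-empty {G} G-empty v = sum-zero vanish
    where
    vanish : ∀ u → (if G u then D v u else 0) ≡ 0
    vanish u with G u in Gu
    ... | true  = contradiction Gu (G-empty u)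
    ... | false = refl

  degIn-< : ∀ F {u w} → F w ≡ false → 0 < E u w → degIn F u < degX u
  degIn-< F {u} {w} Fw 0<E = begin-strict
      degIn F u                                                <⟨ m<m+n (degIn F u) (D-pos 0<E) ⟩
      degIn F u + D u w                                        ≡⟨ cong (degIn F u +_) (sum-*δ (D u) w) ⟨
      degIn F u + sum (λ z → D u z * δ w z)                    ≡⟨ ∑-distrib-+ (λ z → if F z then D u z else 0) (λ z → D u z * δ w z) ⟨
      sum (λ z → (if F z then D u z else 0) + D u z * δ w z)   ≤⟨ sum-mono-≤ bounded ⟩
      degX u                                                   ∎
    where
    open ≤-Reasoning
    bounded : ∀ z → (if F z then D u z else 0) + D u z * δ w z ≤ D u z
    bounded z with z ≟ w
    ... | yes refl rewrite Fw | δ-refl z = ≤-reflexive (*-identityʳ (D u z))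
    ... | no  z≢w  rewrite δ-≢ z≢w | *-zeroʳ (D u z) | +-identityʳ (if F z then D u z else 0) = if-≤ (F z) (D u z)

  exit : ∀ F {u} → F u ≡ true → SinkReachable u → ∃ λ v → F v ≡ true × degIn F v < deg v
  exit F {u} Fu (direct 0<S) = u , Fu , subst (degIn F u <_) (sym (deg≡degX+S u))
    (≤-<-trans (sum-mono-≤ λ z → if-≤ (F z) (D u z)) (m<m+n (degX u) 0<S))
  exit F {u} Fu (via {w = w} 0<E p) with F w in Fw
  ... | true  = exit F Fw p
  ... | false = u , Fu , subst (degIn F u <_) (sym (deg≡degX+S u))
                              (<-≤-trans (degIn-< F Fw 0<E) (m≤m+n (degX u) (S u)))

  noForbiddenIn-∅ : ∀ {c} → NoForbiddenIn (λ _ → ⊥) c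
  noForbiddenIn-∅ .allowedVertex F F⊆∅ (u , Fu) = contradiction (F⊆∅ u Fu) λ ()

  noForbiddenIn-⊆ : ∀ {P Q c} → (∀ u → Q u → P u) → NoForbiddenIn P c → NoForbiddenIn Q c
  noForbiddenIn-⊆ Q⊆P c-ok .allowedVertex F F⊆Q = allowedVertex c-ok F (λ u Fu → Q⊆P u (F⊆Q u Fu))

  noForbiddenIn-≤ : ∀ {P c c′} → (∀ v → lookup c v ≤ lookup c′ v) → NoForbiddenIn P c → NoForbiddenIn P c′
  noForbiddenIn-≤ c≤c′ c-ok .allowedVertex F F⊆P F≠∅ =
    let (v , Fv , degIn≤c) = allowedVertex c-ok F F⊆P F≠∅ in v , Fv , ≤-trans degIn≤c (c≤c′ v)

  noForbiddenIn-≥deg∸1 : (∀ v → SinkReachable v) → ∀ {P c} → (∀ v → deg v ∸ 1 ≤ lookup c v) → NoForbiddenIn P c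
  noForbiddenIn-≥deg∸1 sinkReachable c-large .allowedVertex F _ (u , Fu) =
    let (v , Fv , degIn<deg) = exit F Fu (sinkReachable u) in v , Fv , ≤-trans (∸-monoˡ-≤ 1 degIn<deg) (c-large v)

  -- Dhar's burning argument: a set containing the vertex x that has just toppled is not forbidden.
  noForbiddenIn-topple : ∀ {P c} x → deg x ≤ lookup c x → NoForbiddenIn P c →
    NoForbiddenIn (λ u → P u ⊎ u ≡ x) (toppleAt x c)
  noForbiddenIn-topple {P} {c} x x-unstable c-ok = record { allowedVertex = allowed }
    where
    c′ = toppleAt x c

    inP : ∀ {u} → P u ⊎ u ≡ x → u ≢ x → P u
    inP (inj₁ Pu)  _   = Pu
    inP (inj₂ u≡x) u≢x = contradiction u≡x u≢x

    avoidingX : ∀ F → F x ≡ false → (∀ u → F u ≡ true → P u ⊎ u ≡ x) → ∃ (λ u → F u ≡ true) →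
                ∃ λ v → F v ≡ true × degIn F v ≤ lookup c′ v
    avoidingX F Fx F⊆ F≠∅ =
      v , Fv , ≤-trans degIn≤c (≤-trans (m≤m+n _ _) (≤-reflexive (sym (toppleAt-≢ x c x-unstable (≢x Fv)))))
      where
      ≢x : ∀ {u} → F u ≡ true → u ≢ x
      ≢x Fu refl = contradiction (trans (sym Fx) Fu) λ ()
      found = allowedVertex c-ok F (λ u Fu → inP (F⊆ u Fu) (≢x Fu)) F≠∅
      v = proj₁ found
      Fv = proj₁ (proj₂ found)
      degIn≤c = proj₂ (proj₂ found)

    besidesX : ∀ F → F x ≡ true → (∀ u → F u ≡ true → P u ⊎ u ≡ x) → ∃ (λ u → (F ∖ x) u ≡ true) →
               ∃ λ v → F v ≡ true × degIn F v ≤ lookup c′ v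
    besidesX F Fx F⊆ F∖x≠∅ = v , proj₁ (∖-true F x F∖x-v) , (begin
        degIn F v                ≡⟨ degIn-∖ F x Fx v ⟩
        degIn (F ∖ x) v + D v x  ≤⟨ +-monoˡ-≤ (D v x) degIn≤c ⟩
        lookup c v + D v x       ≡⟨ cong (lookup c v +_) (D-sym v x) ⟩
        lookup c v + D x v       ≡⟨ toppleAt-≢ x c x-unstable (proj₂ (∖-true F x F∖x-v)) ⟨
        lookup c′ v              ∎)
      where
      open ≤-Reasoning
      F∖x⊆P : ∀ u → (F ∖ x) u ≡ true → P u
      F∖x⊆P u F∖x-u = let (Fu , u≢x) = ∖-true F x F∖x-u in inP (F⊆ u Fu) u≢x
      found = allowedVertex c-ok (F ∖ x) F∖x⊆P F∖x≠∅
      v = proj₁ found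
      F∖x-v = proj₁ (proj₂ found)
      degIn≤c = proj₂ (proj₂ found)

    onlyX : ∀ F → F x ≡ true → (∀ u → (F ∖ x) u ≢ true) → degIn F x ≤ lookup c′ x
    onlyX F Fx rest-empty = begin
        degIn F x                ≡⟨ degIn-∖ F x Fx x ⟩
        degIn (F ∖ x) x + D x x  ≡⟨ cong (_+ D x x) (degIn-empty rest-empty x) ⟩
        D x x                    ≤⟨ +-cancelʳ-≤ (deg x) (D x x) (lookup c′ x) (begin
                                      D x x + deg x           ≤⟨ +-monoʳ-≤ (D x x) x-unstable ⟩
                                      D x x + lookup c x      ≡⟨ +-comm (D x x) (lookup c x) ⟩
                                      lookup c x + D x x      ≡⟨ toppleAt-self x c x-unstable ⟨
                                      lookup c′ x + deg x     ∎) ⟩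
        lookup c′ x              ∎
      where open ≤-Reasoning

    allowed : ∀ F → (∀ u → F u ≡ true → P u ⊎ u ≡ x) → ∃ (λ u → F u ≡ true) →
              ∃ λ v → F v ≡ true × degIn F v ≤ lookup c′ v
    allowed F F⊆ F≠∅ with F x in Fx
    ... | false = avoidingX F Fx F⊆ F≠∅
    ... | true with any? (λ u → (F ∖ x) u Bool.≟ true)
    ...   | yes F∖x≠∅ = besidesX F Fx F⊆ F∖x≠∅
    ...   | no  F∖x=∅ = x , Fx , onlyX F Fx (λ u F∖x-u → F∖x=∅ (u , F∖x-u))

  noForbiddenIn-run : ∀ {P c d} → NoForbiddenIn P c → (st : Star _⟶_ c d) →
    NoForbiddenIn (λ u → P u ⊎ 0 < topplings st u) d
  noForbiddenIn-run c-ok ε = noForbiddenIn-⊆ (λ { u (inj₁ Pu) → Pu ; u (inj₂ ()) }) c-ok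
  noForbiddenIn-run {P} c-ok (topple x x-unstable ◅ st) =
    noForbiddenIn-⊆ toppledEarlier (noForbiddenIn-run (noForbiddenIn-topple x x-unstable c-ok) st)
    where
    toppledEarlier : ∀ u → P u ⊎ 0 < δ x u + topplings st u → (P u ⊎ u ≡ x) ⊎ 0 < topplings st u
    toppledEarlier u (inj₁ Pu) = inj₁ (inj₁ Pu)
    toppledEarlier u (inj₂ toppled) with u ≟ x
    ... | yes u≡x = inj₁ (inj₂ u≡x)
    ... | no  u≢x = inj₂ (subst (λ k → 0 < k + topplings st u) (δ-≢ u≢x) toppled)

  noForbidden-run : ∀ {c d} → NoForbidden c → Star _⟶_ c d → NoForbidden d
  noForbidden-run c-ok st = noForbiddenIn-⊆ (λ _ _ → inj₁ tt) (noForbiddenIn-run c-ok st)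

  -- c = Δ (b − a) for the reduced Laplacian Δ t v = deg v * t v − received t v, stated without subtraction
  LaplacianImage : Config → (Fin n → ℕ) → (Fin n → ℕ) → Set
  LaplacianImage c a b = ∀ v → lookup c v + deg v * a v + received b v ≡ deg v * b v + received a v

  laplacianImage-run : ∀ {c d a b} → LaplacianImage c a b → (st : Star _⟶_ c d) →
    LaplacianImage d (λ u → a u + topplings st u) b
  laplacianImage-run {c} {d} {a} {b} c-image st v = begin
      lookup d v + deg v * (a v + t v) + received b v
        ≡⟨ cong (λ k → lookup d v + k + received b v) (*-distribˡ-+ (deg v) (a v) (t v)) ⟩
      lookup d v + (deg v * a v + deg v * t v) + received b v
        ≡⟨ rearrange (lookup d v) (deg v * a v) (deg v * t v) (received b v) ⟩
      (lookup d v + deg v * t v) + (deg v * a v + received b v)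
        ≡⟨ cong (_+ (deg v * a v + received b v)) (run-balance st v) ⟩
      (lookup c v + received t v) + (deg v * a v + received b v)
        ≡⟨ rearrange′ (lookup c v) (received t v) (deg v * a v) (received b v) ⟩
      (lookup c v + deg v * a v + received b v) + received t v
        ≡⟨ cong (_+ received t v) (c-image v) ⟩
      (deg v * b v + received a v) + received t v
        ≡⟨ +-assoc (deg v * b v) (received a v) (received t v) ⟩
      deg v * b v + (received a v + received t v)
        ≡⟨ cong (deg v * b v +_) (received-+ a t v) ⟨
      deg v * b v + received (λ u → a u + t u) v
        ∎
    where
    open ≡-Reasoning
    t = topplings st
    rearrange : ∀ p q r s → p + (q + r) + s ≡ (p + r) + (q + s)
    rearrange = solve-∀
    rearrange′ : ∀ p q r s → (p + q) + (r + s) ≡ (p + r + s) + q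
    rearrange′ = solve-∀

  laplacianImage-⊞ : ∀ {c c′ a a′ b b′} → LaplacianImage c a b → LaplacianImage c′ a′ b′ →
    LaplacianImage (c ⊞ c′) (λ u → a u + a′ u) (λ u → b u + b′ u)
  laplacianImage-⊞ {c} {c′} {a} {a′} {b} {b′} c-image c′-image v = begin
      lookup (c ⊞ c′) v + deg v * (a v + a′ v) + received (λ u → b u + b′ u) v
        ≡⟨ cong₂ (λ p q → p + deg v * (a v + a′ v) + q) (lookup-⊞ c c′ v) (received-+ b b′ v) ⟩
      (lookup c v + lookup c′ v) + deg v * (a v + a′ v) + (received b v + received b′ v)
        ≡⟨ cong (λ k → (lookup c v + lookup c′ v) + k + (received b v + received b′ v)) (*-distribˡ-+ (deg v) (a v) (a′ v)) ⟩
      (lookup c v + lookup c′ v) + (deg v * a v + deg v * a′ v) + (received b v + received b′ v)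
        ≡⟨ rearrange (lookup c v) (lookup c′ v) (deg v * a v) (deg v * a′ v) (received b v) (received b′ v) ⟩
      (lookup c v + deg v * a v + received b v) + (lookup c′ v + deg v * a′ v + received b′ v)
        ≡⟨ cong₂ _+_ (c-image v) (c′-image v) ⟩
      (deg v * b v + received a v) + (deg v * b′ v + received a′ v)
        ≡⟨ interchange (deg v * b v) (received a v) (deg v * b′ v) (received a′ v) ⟩
      (deg v * b v + deg v * b′ v) + (received a v + received a′ v)
        ≡⟨ cong₂ _+_ (*-distribˡ-+ (deg v) (b v) (b′ v)) (received-+ a a′ v) ⟨
      deg v * (b v + b′ v) + received (λ u → a u + a′ u) v
        ∎
    where
    open ≡-Reasoning
    rearrange : ∀ p p′ q q′ r r′ → (p + p′) + (q + q′) + (r + r′) ≡ (p + q + r) + (p′ + q′ + r′)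
    rearrange = solve-∀

  absorbed-balance : ∀ {c d} (st : Star _⟶_ (c ⊞ d) d) v →
    lookup c v + received (topplings st) v ≡ deg v * topplings st v
  absorbed-balance {c} {d} st v = +-cancelˡ-≡ (lookup d v) _ _ (begin
      lookup d v + (lookup c v + received t v)  ≡⟨ x∙yz≈yx∙z (lookup d v) (lookup c v) (received t v) ⟩
      (lookup c v + lookup d v) + received t v  ≡⟨ cong (_+ received t v) (lookup-⊞ c d v) ⟨
      lookup (c ⊞ d) v + received t v           ≡⟨ run-balance st v ⟨
      lookup d v + deg v * t v                  ∎)
    where
    open ≡-Reasoning
    t = topplings st

  laplacianImage-absorbed : ∀ {c d} (st : Star _⟶_ (c ⊞ d) d) → LaplacianImage c (λ _ → 0) (topplings st)
  laplacianImage-absorbed {c} st v = begin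
      lookup c v + deg v * 0 + received t v   ≡⟨ cong (λ k → lookup c v + k + received t v) (*-zeroʳ (deg v)) ⟩
      lookup c v + 0 + received t v           ≡⟨ cong (_+ received t v) (+-identityʳ (lookup c v)) ⟩
      lookup c v + received t v               ≡⟨ absorbed-balance st v ⟩
      deg v * t v                             ≡⟨ +-identityʳ (deg v * t v) ⟨
      deg v * t v + 0                         ≡⟨ cong (deg v * t v +_) (received-zero v) ⟨
      deg v * t v + received (λ _ → 0) v      ∎
    where
    open ≡-Reasoning
    t = topplings st

  stable-absorbed-≡0 : ∀ {c d} → Stable c → (st : Star _⟶_ (c ⊞ d) d) →
    ∀ v → received (topplings st) v ≡ 0 → lookup c v ≡ 0
  stable-absorbed-≡0 {c} c-stable st v nothing-received = <-multiple⇒≡0 (topplings st v) (c-stable v)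
    (trans (sym (trans (cong (lookup c v +_) nothing-received) (+-identityʳ (lookup c v)))) (absorbed-balance st v))

  absorbed-topplings-≡0 : ConnectedX → ∀ {c d} (st : Star _⟶_ (c ⊞ d) d) →
    ∀ {v} → topplings st v ≡ 0 → ∀ u → topplings st u ≡ 0
  absorbed-topplings-≡0 connected {c} st {v} tv≡0 u = along (connected v u) tv≡0
    where
    t = topplings st
    spread : ∀ {u u′} → 0 < E u u′ → t u ≡ 0 → t u′ ≡ 0
    spread {u} {u′} 0<E tu≡0 = n≤0⇒n≡0 (begin
        t u′                        ≤⟨ m≤n*m (t u′) (D u′ u) {{>-nonZero (D-pos (subst (0 <_) (symE u u′) 0<E))}} ⟩
        D u′ u * t u′               ≤⟨ ≤-sum (λ z → D z u * t z) u′ ⟩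
        received t u                ≤⟨ m≤n+m (received t u) (lookup c u) ⟩
        lookup c u + received t u   ≡⟨ absorbed-balance st u ⟩
        deg u * t u                 ≡⟨ cong (deg u *_) tu≡0 ⟩
        deg u * 0                   ≡⟨ *-zeroʳ (deg u) ⟩
        0                           ∎)
      where open ≤-Reasoning
    along : ∀ {a b} → PathX a b → t a ≡ 0 → t b ≡ 0
    along here          ta≡0 = ta≡0
    along (step 0<E p)  ta≡0 = along p (spread 0<E ta≡0)

  -- w = P − Q + K, shifted by K to stay in ℕ: constants are harmonic up to the loss S v * K to the sink.
  shifted-balance : ∀ {x y} (P Q w : Fin n → ℕ) K → (∀ u → w u + Q u ≡ P u + K) →
    (∀ v → lookup x v + deg v * Q v + received P v ≡ lookup y v + deg v * P v + received Q v) →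
    ∀ v → lookup x v + received w v + S v * K ≡ lookup y v + deg v * w v
  shifted-balance {x} {y} P Q w K w+Q≡P+K balance v = +-cancelʳ-≡ (deg v * Q v + received Q v) _ _ (begin
      (X + received w v + S v * K) + (deg v * Q v + received Q v)
        ≡⟨ rearrange₁ X (received w v) (S v * K) (deg v * Q v) (received Q v) ⟩
      (X + deg v * Q v) + (received w v + received Q v) + S v * K
        ≡⟨ cong (λ k → (X + deg v * Q v) + k + S v * K) received-shift ⟩
      (X + deg v * Q v) + (received P v + degX v * K) + S v * K
        ≡⟨ rearrange₂ (X + deg v * Q v) (received P v) (degX v * K) (S v * K) ⟩
      (X + deg v * Q v + received P v) + (degX v * K + S v * K)
        ≡⟨ cong₂ _+_ (balance v) (sym (*-distribʳ-+ K (degX v) (S v))) ⟩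
      (Y + deg v * P v + received Q v) + (degX v + S v) * K
        ≡⟨ cong (λ d → (Y + deg v * P v + received Q v) + d * K) (deg≡degX+S v) ⟨
      (Y + deg v * P v + received Q v) + deg v * K
        ≡⟨ rearrange₃ Y (deg v * P v) (received Q v) (deg v * K) ⟩
      Y + (deg v * P v + deg v * K) + received Q v
        ≡⟨ cong (λ k → Y + k + received Q v) degree-shift ⟨
      Y + (deg v * w v + deg v * Q v) + received Q v
        ≡⟨ rearrange₄ Y (deg v * w v) (deg v * Q v) (received Q v) ⟩
      (Y + deg v * w v) + (deg v * Q v + received Q v)
        ∎)
    where
    open ≡-Reasoning
    X = lookup x v
    Y = lookup y v
    received-shift : received w v + received Q v ≡ received P v + degX v * K
    received-shift = begin
      received w v + received Q v             ≡⟨ received-+ w Q v ⟨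
      received (λ u → w u + Q u) v            ≡⟨ sum-cong-≗ (λ u → cong (D u v *_) (w+Q≡P+K u)) ⟩
      received (λ u → P u + K) v              ≡⟨ received-+ P (λ _ → K) v ⟩
      received P v + received (λ _ → K) v     ≡⟨ cong (received P v +_) (received-const K v) ⟩
      received P v + degX v * K               ∎
    degree-shift : deg v * w v + deg v * Q v ≡ deg v * P v + deg v * K
    degree-shift = begin
      deg v * w v + deg v * Q v   ≡⟨ *-distribˡ-+ (deg v) (w v) (Q v) ⟨
      deg v * (w v + Q v)         ≡⟨ cong (deg v *_) (w+Q≡P+K v) ⟩
      deg v * (P v + K)           ≡⟨ *-distribˡ-+ (deg v) (P v) K ⟩
      deg v * P v + deg v * K     ∎
    rearrange₁ : ∀ a b c d e → (a + b + c) + (d + e) ≡ (a + d) + (b + e) + c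
    rearrange₁ = solve-∀
    rearrange₂ : ∀ a b c d → a + (b + c) + d ≡ (a + b) + (c + d)
    rearrange₂ = solve-∀
    rearrange₃ : ∀ a b c d → (a + b + c) + d ≡ a + (b + d) + c
    rearrange₃ = solve-∀
    rearrange₄ : ∀ a b c d → a + (b + c) + d ≡ (a + b) + (c + d)
    rearrange₄ = solve-∀

  -- A discrete maximum principle: the set F where w is maximal is not forbidden for y, and at a
  -- vertex v of F with enough grains the balance equation makes x unstable unless max w ≤ K.
  maximum-principle : ∀ {x y} (w : Fin n → ℕ) K → Stable x → NoForbidden y →
    (∀ v → lookup x v + received w v + S v * K ≡ lookup y v + deg v * w v) → ∀ v → w v ≤ K
  maximum-principle {x} {y} w K x-stable y-ok balance v₀ with argmax w v₀
  ... | m , w≤M = ≤-trans (w≤M v₀) (≮⇒≥ K≮M)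
    where
    M = w m

    F : Fin n → Bool
    F u = w u ℕ.≡ᵇ M

    onMax : ∀ {u} → F u ≡ true → w u ≡ M
    onMax {u} Fu = ≡ᵇ⇒≡ (w u) M (Equivalence.from Bool.T-≡ Fu)

    offMax : ∀ {u} → F u ≡ false → w u ≢ M
    offMax {u} Fu wu≡M = subst T Fu (≡⇒≡ᵇ (w u) M wu≡M)

    K≮M : ¬ K < M
    K≮M K<M = <⇒≱ (x-stable v) deg≤x
      where
      found = allowedVertex y-ok F (λ _ _ → tt) (m , Equivalence.to Bool.T-≡ (≡⇒≡ᵇ M M refl))
      v = proj₁ found
      wv≡M = onMax (proj₁ (proj₂ found))
      degIn≤y = proj₂ (proj₂ found)
      R = degX v
      outside = sum (λ u → if F u then 0 else D v u)

      degIn+outside : degIn F v + outside ≡ R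
      degIn+outside = trans (sym (∑-distrib-+ (λ u → if F u then D v u else 0) (λ u → if F u then 0 else D v u)))
                            (sum-cong-≗ λ u → split (F u) (D v u))
        where
        split : ∀ b d → (if b then d else 0) + (if b then 0 else d) ≡ d
        split true  d = +-identityʳ d
        split false d = refl

      received+outside≤ : received w v + outside ≤ R * M
      received+outside≤ = begin
          received w v + outside                                      ≡⟨ ∑-distrib-+ (λ u → D u v * w u) (λ u → if F u then 0 else D v u) ⟨
          sum (λ u → D u v * w u + (if F u then 0 else D v u))        ≤⟨ sum-mono-≤ bounded ⟩
          sum (λ u → D v u * M)                                       ≡⟨ *-distribʳ-sum M (D v) ⟨
          R * M                                                       ∎
        where
        open ≤-Reasoning
        bounded : ∀ u → D u v * w u + (if F u then 0 else D v u) ≤ D v u * M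
        bounded u = subst (λ d → d * w u + (if F u then 0 else D v u) ≤ D v u * M) (D-sym v u) (bounded′ u (F u) refl)
          where
          bounded′ : ∀ u b → F u ≡ b → D v u * w u + (if b then 0 else D v u) ≤ D v u * M
          bounded′ u true  Fu rewrite onMax Fu = ≤-reflexive (+-identityʳ (D v u * M))
          bounded′ u false Fu = begin
            D v u * w u + D v u  ≡⟨ +-comm (D v u * w u) (D v u) ⟩
            D v u + D v u * w u  ≡⟨ *-suc (D v u) (w u) ⟨
            D v u * suc (w u)    ≤⟨ *-monoʳ-≤ (D v u) (≤∧≢⇒< (w≤M u) (offMax Fu)) ⟩
            D v u * M            ∎

      R+SM≤x+SK : R + S v * M ≤ lookup x v + S v * K
      R+SM≤x+SK = +-cancelʳ-≤ (R * M) _ _ (begin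
          (R + S v * M) + R * M
            ≡⟨ cong (λ r → (r + S v * M) + R * M) degIn+outside ⟨
          (degIn F v + outside + S v * M) + R * M
            ≡⟨ rearrange (degIn F v) outside (S v * M) (R * M) ⟩
          (degIn F v + (R * M + S v * M)) + outside
            ≤⟨ +-monoˡ-≤ outside (+-monoˡ-≤ (R * M + S v * M) degIn≤y) ⟩
          (lookup y v + (R * M + S v * M)) + outside
            ≡⟨ cong (λ k → (lookup y v + k) + outside) (*-distribʳ-+ M R (S v)) ⟨
          (lookup y v + (R + S v) * M) + outside
            ≡⟨ cong (λ d → (lookup y v + d * M) + outside) (deg≡degX+S v) ⟨
          (lookup y v + deg v * M) + outside
            ≡⟨ cong (λ k → (lookup y v + deg v * k) + outside) wv≡M ⟨
          (lookup y v + deg v * w v) + outside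
            ≡⟨ cong (_+ outside) (balance v) ⟨
          (lookup x v + received w v + S v * K) + outside
            ≡⟨ rearrange′ (lookup x v) (received w v) (S v * K) outside ⟩
          (lookup x v + S v * K) + (received w v + outside)
            ≤⟨ +-monoʳ-≤ (lookup x v + S v * K) received+outside≤ ⟩
          (lookup x v + S v * K) + R * M
            ∎)
        where
        open ≤-Reasoning
        rearrange : ∀ a b c d → (a + b + c) + d ≡ (a + (d + c)) + b
        rearrange = solve-∀
        rearrange′ : ∀ a b c d → (a + b + c) + d ≡ (a + c) + (b + d)
        rearrange′ = solve-∀

      deg≤x : deg v ≤ lookup x v
      deg≤x = +-cancelʳ-≤ (S v * K) _ _ (begin
          deg v + S v * K          ≡⟨ cong (_+ S v * K) (deg≡degX+S v) ⟩
          R + S v + S v * K        ≡⟨ +-assoc R (S v) (S v * K) ⟩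
          R + (S v + S v * K)      ≡⟨ cong (R +_) (*-suc (S v) K) ⟨
          R + S v * suc K          ≤⟨ +-monoʳ-≤ R (*-monoʳ-≤ (S v) K<M) ⟩
          R + S v * M              ≤⟨ R+SM≤x+SK ⟩
          lookup x v + S v * K     ∎)
        where open ≤-Reasoning

  laplacian-comparison : ∀ {x y} (P Q : Fin n → ℕ) → Stable x → NoForbidden y →
    (∀ v → lookup x v + deg v * Q v + received P v ≡ lookup y v + deg v * P v + received Q v) →
    ∀ v → P v ≤ Q v
  laplacian-comparison {x} {y} P Q x-stable y-ok balance v with P v ≤? Q v
  ... | yes P≤Q = P≤Q
  ... | no  P≰Q = contradiction (maximum-principle {x} {y} w K x-stable y-ok shifted v) (<⇒≱ K<w)
    where
    K = sum Q
    w : Fin n → ℕ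
    w u = P u + K ∸ Q u
    w+Q≡P+K : ∀ u → w u + Q u ≡ P u + K
    w+Q≡P+K u = m∸n+n≡m (≤-trans (≤-sum Q u) (m≤n+m K (P u)))
    shifted = shifted-balance {x} {y} P Q w K w+Q≡P+K balance
    K<w : K < w v
    K<w = +-cancelʳ-< (Q v) K (w v) (begin-strict
        K + Q v      ≡⟨ +-comm K (Q v) ⟩
        Q v + K      <⟨ +-monoˡ-< K (≰⇒> P≰Q) ⟩
        P v + K      ≡⟨ w+Q≡P+K v ⟨
        w v + Q v    ∎)
      where open ≤-Reasoning

  laplacianImage-unique : ∀ {x y a b a′ b′} → Stable x → Stable y → NoForbidden x → NoForbidden y →
    LaplacianImage x a b → LaplacianImage y a′ b′ → x ≡ y
  laplacianImage-unique {x} {y} {a} {b} {a′} {b′} x-stable y-stable x-ok y-ok x-image y-image =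
    lookup-extensionality λ v → +-cancelʳ-≡ (deg v * Q v + received P v) _ _ (begin
      lookup x v + (deg v * Q v + received P v)  ≡⟨ +-assoc (lookup x v) _ _ ⟨
      lookup x v + deg v * Q v + received P v    ≡⟨ balance v ⟩
      lookup y v + deg v * P v + received Q v    ≡⟨ cong₂ (λ p q → lookup y v + deg v * p + q) (P≡Q v)
                                                          (sum-cong-≗ λ u → cong (D u v *_) (sym (P≡Q u))) ⟩
      lookup y v + deg v * Q v + received P v    ≡⟨ +-assoc (lookup y v) _ _ ⟩
      lookup y v + (deg v * Q v + received P v)  ∎)
    where
    open ≡-Reasoning
    P Q : Fin n → ℕ
    P u = b u + a′ u
    Q u = a u + b′ u

    balance : ∀ v → lookup x v + deg v * Q v + received P v ≡ lookup y v + deg v * P v + received Q v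
    balance v = begin
        lookup x v + deg v * Q v + received P v
          ≡⟨ cong₂ (λ p q → lookup x v + p + q) (*-distribˡ-+ (deg v) (a v) (b′ v)) (received-+ b a′ v) ⟩
        lookup x v + (deg v * a v + deg v * b′ v) + (received b v + received a′ v)
          ≡⟨ rearrange (lookup x v) (deg v * a v) (deg v * b′ v) (received b v) (received a′ v) ⟩
        (lookup x v + deg v * a v + received b v) + (deg v * b′ v + received a′ v)
          ≡⟨ cong₂ _+_ (x-image v) (sym (y-image v)) ⟩
        (deg v * b v + received a v) + (lookup y v + deg v * a′ v + received b′ v)
          ≡⟨ rearrange′ (deg v * b v) (received a v) (lookup y v) (deg v * a′ v) (received b′ v) ⟩
        lookup y v + (deg v * b v + deg v * a′ v) + (received a v + received b′ v)
          ≡⟨ cong₂ (λ p q → lookup y v + p + q) (*-distribˡ-+ (deg v) (b v) (a′ v)) (received-+ a b′ v) ⟨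
        lookup y v + deg v * P v + received Q v
          ∎
      where
      rearrange : ∀ p q r s t → p + (q + r) + (s + t) ≡ (p + q + s) + (r + t)
      rearrange = solve-∀
      rearrange′ : ∀ p q r s t → (p + q) + (r + s + t) ≡ r + (p + s) + (q + t)
      rearrange′ = solve-∀

    P≡Q : ∀ u → P u ≡ Q u
    P≡Q u = ≤-antisym (laplacian-comparison {x} {y} P Q x-stable y-ok balance u)
                      (laplacian-comparison {y} {x} Q P y-stable x-ok (sym ∘ balance) u)

  zeroC-idempotent : (∀ v → 0 < deg v) → Idempotent zeroC
  zeroC-idempotent deg>0 = zeroC-stable , subst (Star _⟶_ (zeroC ⊞ zeroC)) zeroC⊞zeroC ε , zeroC-stable
    where
    zeroC-stable : Stable zeroC
    zeroC-stable v = subst (_< deg v) (sym (lookup-zeroC v)) (deg>0 v)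
    zeroC⊞zeroC : zeroC ⊞ zeroC ≡ zeroC
    zeroC⊞zeroC = ≡zeroC λ v → trans (lookup-⊞ zeroC zeroC v) (cong₂ _+_ (lookup-zeroC v) (lookup-zeroC v))

  idempotent-edgeless : (∀ u v → E u v ≡ 0) → ∀ e → Idempotent e → e ≡ zeroC
  idempotent-edgeless E≡0 e (e-stable , ee-run , _) = ≡zeroC λ v →
    stable-absorbed-≡0 e-stable ee-run v (sum-zero λ u → cong (_* topplings ee-run u) (D-zero E≡0 u v))

  singleLoopless⇒edgeless : SingleLooplessVertex → ∀ u v → E u v ≡ 0
  singleLoopless⇒edgeless (n≡1 , loopless) u v rewrite Fin-unique n≡1 u v = loopless v

  neighbour : ConnectedX → ¬ SingleLooplessVertex → ∀ v → ∃ λ w → 0 < E v w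
  neighbour connected not-single v with any? (λ u → ¬? (u ≟ v))
  ... | yes (u , u≢v) with connected v u
  ...   | here        = contradiction refl u≢v
  ...   | step 0<E _  = _ , 0<E
  neighbour connected not-single v | no no-other with 0 <? E v v
  ...   | yes loop    = v , loop
  ...   | no  no-loop = contradiction (unique⇒≡1 v only-v , loopless) not-single
    where
    only-v : ∀ u → u ≡ v
    only-v u with u ≟ v
    ... | yes u≡v = u≡v
    ... | no  u≢v = contradiction (u , u≢v) no-other
    loopless : ∀ u → E u u ≡ 0
    loopless u rewrite only-v u = n≤0⇒n≡0 (≮⇒≥ no-loop)

  neighbour⇒degX>0 : ∀ {v} → ∃ (λ w → 0 < E v w) → 0 < degX v
  neighbour⇒degX>0 {v} (w , 0<E) = ≤-trans (D-pos 0<E) (≤-sum (D v) w)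

  module Identity (sinkReachable : ∀ v → SinkReachable v) where
    open Stabilization sinkReachable

    cmax : Config
    cmax = tabulate λ v → deg v ∸ 1

    stable⇒≤cmax : ∀ {c} → Stable c → ∀ v → lookup c v ≤ lookup cmax v
    stable⇒≤cmax c-stable v = ≤-trans (∸-monoˡ-≤ 1 (c-stable v)) (≤-reflexive (sym (lookup∘tabulate _ v)))

    -- The identity of the sandpile group is the stabilization of 2 cmax − (2 cmax)°.
    2cmax° : Config
    2cmax° = proj₁ (stabilize (cmax ⊞ cmax))

    2cmax°-stable : Stable 2cmax°
    2cmax°-stable = proj₂ (proj₂ (stabilize (cmax ⊞ cmax)))

    y₀ : Config
    y₀ = tabulate λ v → lookup (cmax ⊞ cmax) v ∸ lookup 2cmax° v

    y₀⊞2cmax° : y₀ ⊞ 2cmax° ≡ cmax ⊞ cmax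
    y₀⊞2cmax° = lookup-extensionality λ v →
      trans (lookup-⊞ y₀ 2cmax° v)
            (trans (cong (_+ lookup 2cmax° v) (lookup∘tabulate _ v)) (m∸n+n≡m (2cmax°≤ v)))
      where
      2cmax°≤ : ∀ v → lookup 2cmax° v ≤ lookup (cmax ⊞ cmax) v
      2cmax°≤ v = ≤-trans (stable⇒≤cmax {2cmax°} 2cmax°-stable v)
                          (≤-trans (m≤m+n _ _) (≤-reflexive (sym (lookup-⊞ cmax cmax v))))

    y₀-run : Star _⟶_ (y₀ ⊞ 2cmax°) 2cmax°
    y₀-run = subst (λ c → Star _⟶_ c 2cmax°) (sym y₀⊞2cmax°) (proj₁ (proj₂ (stabilize (cmax ⊞ cmax))))

    cmax≤y₀ : ∀ v → deg v ∸ 1 ≤ lookup y₀ v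
    cmax≤y₀ v = +-cancelʳ-≤ (lookup 2cmax° v) _ _ (begin
        (deg v ∸ 1) + lookup 2cmax° v                ≤⟨ +-monoʳ-≤ (deg v ∸ 1) (stable⇒≤cmax {2cmax°} 2cmax°-stable v) ⟩
        (deg v ∸ 1) + lookup cmax v                  ≡⟨ cong (_+ lookup cmax v) (lookup∘tabulate _ v) ⟨
        lookup cmax v + lookup cmax v                ≡⟨ lookup-⊞ cmax cmax v ⟨
        lookup (cmax ⊞ cmax) v                       ≡⟨ cong (λ c → lookup c v) y₀⊞2cmax° ⟨
        lookup (y₀ ⊞ 2cmax°) v                       ≡⟨ lookup-⊞ y₀ 2cmax° v ⟩
        lookup y₀ v + lookup 2cmax° v                ∎)
      where open ≤-Reasoning

    y₀-noForbidden : NoForbidden y₀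
    y₀-noForbidden = noForbiddenIn-≥deg∸1 sinkReachable cmax≤y₀

    y₀-image : LaplacianImage y₀ (λ _ → 0) (topplings y₀-run)
    y₀-image = laplacianImage-absorbed y₀-run

    g : Config
    g = proj₁ (stabilize y₀)

    g-run : Star _⟶_ y₀ g
    g-run = proj₁ (proj₂ (stabilize y₀))

    g-stable : Stable g
    g-stable = proj₂ (proj₂ (stabilize y₀))

    g-noForbidden : NoForbidden g
    g-noForbidden = noForbidden-run y₀-noForbidden g-run

    ≡g : ∀ {e a b} → Stable e → NoForbidden e → LaplacianImage e a b → e ≡ g
    ≡g e-stable e-ok e-image =
      laplacianImage-unique e-stable g-stable e-ok g-noForbidden e-image (laplacianImage-run y₀-image g-run)

    reachedFrom-y₀ : ∀ {d} → Star _⟶_ y₀ d → Stable d → d ≡ g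
    reachedFrom-y₀ st d-stable = ≡g d-stable (noForbidden-run y₀-noForbidden st) (laplacianImage-run y₀-image st)

    g-idempotent : Idempotent g
    g-idempotent with stabilize (g ⊞ g)
    ... | gg , gg-run , gg-stable = g-stable , subst (Star _⟶_ (g ⊞ g)) gg≡g gg-run , g-stable
      where
      g≤g⊞g : ∀ v → lookup g v ≤ lookup (g ⊞ g) v
      g≤g⊞g v = ≤-trans (m≤m+n _ _) (≤-reflexive (sym (lookup-⊞ g g v)))
      g-image = laplacianImage-run y₀-image g-run
      gg≡g = ≡g gg-stable (noForbidden-run (noForbiddenIn-≤ g≤g⊞g g-noForbidden) gg-run)
                          (laplacianImage-run (laplacianImage-⊞ {g} {g} g-image g-image) gg-run)

    complement : Config → Config
    complement y = tabulate λ v → lookup y₀ v ∸ lookup y v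

    complement⊞ : ∀ {y} → Stable y → complement y ⊞ y ≡ y₀
    complement⊞ {y} y-stable = lookup-extensionality λ v →
      trans (lookup-⊞ (complement y) y v) (trans (cong (_+ lookup y v) (lookup∘tabulate _ v)) (m∸n+n≡m (y≤y₀ v)))
      where
      y≤y₀ : ∀ v → lookup y v ≤ lookup y₀ v
      y≤y₀ v = ≤-trans (stable⇒≤cmax {y} y-stable v)
                       (≤-trans (≤-reflexive (lookup∘tabulate _ v)) (cmax≤y₀ v))

    g-inMinimalIdeal : InMinimalIdeal g
    g-inMinimalIdeal = g-stable , absorbs
      where
      absorbs : ∀ y → Stable y → ∃ λ z → Stable z × StabilizesTo (y ⊞ z) g
      absorbs y y-stable with stabilize (complement y)
      ... | z , z-run , z-stable with stabilize (y ⊞ z)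
      ...   | q , q-run , q-stable =
        z , z-stable , subst (Star _⟶_ (y ⊞ z)) (reachedFrom-y₀ y₀-to-q q-stable) q-run , g-stable
        where
        y₀-to-q : Star _⟶_ y₀ q
        y₀-to-q = subst₂ (Star _⟶_) (complement⊞ y-stable) (⊞-comm z y) (run-⊞ y z-run) ◅◅ q-run

    g≢zeroC : 0 < n → (∀ v → 0 < degX v) → g ≢ zeroC
    g≢zeroC 0<n degX>0 g≡0 with allowedVertex g-noForbidden (λ _ → true) (λ _ _ → tt) (fromℕ< 0<n , refl)
    ... | v , _ , degX≤g =
      <⇒≱ (degX>0 v) (≤-trans degX≤g (≤-reflexive (trans (cong (λ c → lookup c v) g≡0) (lookup-zeroC v))))

    idempotent-zero-or-g : ConnectedX → ∀ e → Idempotent e → e ≡ zeroC ⊎ e ≡ g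
    idempotent-zero-or-g connected e (e-stable , ee-run , _) with all? (λ v → 1 ≤? topplings ee-run v)
    ... | yes all-toppled = inj₂ (≡g e-stable e-noForbidden (laplacianImage-absorbed ee-run))
      where
      e-noForbidden : NoForbidden e
      e-noForbidden = noForbiddenIn-⊆ (λ u _ → inj₂ (all-toppled u)) (noForbiddenIn-run noForbiddenIn-∅ ee-run)
    ... | no not-all-toppled with ¬∀⟶∃¬ n _ (λ v → 1 ≤? topplings ee-run v) not-all-toppled
    ...   | v , v-idle = inj₁ (≡zeroC λ u → stable-absorbed-≡0 e-stable ee-run u (nothing-received u))
      where
      idle : ∀ u → topplings ee-run u ≡ 0
      idle = absorbed-topplings-≡0 connected ee-run (n≤0⇒n≡0 (≮⇒≥ v-idle))
      nothing-received : ∀ u → received (topplings ee-run) u ≡ 0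
      nothing-received u = sum-zero λ z → trans (cong (D z u *_) (idle z)) (*-zeroʳ (D z u))

theorem4p1 : (n : ℕ) (E : Fin n → Fin n → ℕ) (S : Fin n → ℕ) →
    Symmetric E →
    Sandpile.IsSandpileGraph E S →
    Sandpile.ConnectedX E S →
    let open Sandpile E S in
    (SingleLooplessVertex →
      Idempotent zeroC × (∀ e → Idempotent e → e ≡ zeroC)) ×
    (¬ SingleLooplessVertex →
      Idempotent zeroC ×
      Σ Config λ g →
        Idempotent g × InMinimalIdeal g × ¬ (g ≡ zeroC) ×
        (∀ e → Idempotent e → (e ≡ zeroC) ⊎ (e ≡ g)))
theorem4p1 n E S symE (0<n , sinkReachable) connected =
    (λ single → zeroC-idempotent deg>0 , idempotent-edgeless (singleLoopless⇒edgeless single))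
  , (λ not-single → zeroC-idempotent deg>0 , g , g-idempotent , g-inMinimalIdeal
                  , g≢zeroC 0<n (λ v → neighbour⇒degX>0 (neighbour connected not-single v))
                  , idempotent-zero-or-g connected)
  where
  open Sandpile E S
  open UndirectedSandpile E S symE
  open Identity sinkReachable

  deg>0 : ∀ v → 0 < deg v
  deg>0 v = deg-positive (sinkReachable v)
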